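{- Let $p<q$ be primes and $i$ a positive integer, and let $f(x)\in\mathbb{F}_2[x]$ have degree $m=p^iq$. If $o(f(x))=m$, then $f(x)$ has an irreducible factor of degree $p^i$ or of degree $p^iq$.
   Context: $\mathbb{F}_2$ is the binary field. For $f(x)\in\mathbb{F}_2[x]$ without repeated factors, its order $o(f(x))$ is the least common multiple of the degrees of its irreducible factors (equivalently, the least positive $k$ with $G^k=I_m$, where $G$ is the Berlekamp matrix of $f$, whose $(i+1)$-th row gives the coefficients of $x^{2i}\bmod f$, $i=0,\ldots,m-1$). -}

module Defs where

open import Data.Bool using (Bool; true; false; _xor_; _∧_)
open import Data.List using (List; []; _∷_)
open import Data.Nat using (ℕ; zero; suc; _<_; _≤_)
open import Data.Nat.Divisibility using (_∣_)
open import Data.Product using (Σ; _×_; ∃-syntax)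
open import Data.Sum using (_⊎_)
open import Relation.Binary.PropositionalEquality using (_≡_)

-- Polynomials over F₂ = Bool (xor = addition, ∧ = multiplication),
-- represented by coefficient lists, lowest degree first.
-- Trailing zero coefficients are allowed; equality is coefficientwise.
Poly : Set
Poly = List Bool

coeff : Poly → ℕ → Bool
coeff []       _       = false
coeff (a ∷ _)  zero    = a
coeff (_ ∷ p)  (suc i) = coeff p i

_≈P_ : Poly → Poly → Set
p ≈P q = ∀ i → coeff p i ≡ coeff q i

addP : Poly → Poly → Poly
addP []       q        = q
addP (a ∷ p)  []       = a ∷ p
addP (a ∷ p)  (b ∷ q)  = (a xor b) ∷ addP p q

scaleP : Bool → Poly → Poly
scaleP c []      = []
scaleP c (b ∷ q) = (c ∧ b) ∷ scaleP c q

mulP : Poly → Poly → Poly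
mulP []      q = []
mulP (a ∷ p) q = addP (scaleP a q) (false ∷ mulP p q)

-- the constant polynomial 1 (the only unit of F₂[x])
oneP : Poly
oneP = true ∷ []

HasDegree : Poly → ℕ → Set
HasDegree p d = (coeff p d ≡ true) × (∀ i → d < i → coeff p i ≡ false)

_∣P_ : Poly → Poly → Set
g ∣P f = ∃[ h ] (mulP g h ≈P f)

Irreducible : Poly → Set
Irreducible g =
  (∃[ d ] ((1 ≤ d) × HasDegree g d)) ×
  (∀ a b → mulP a b ≈P g → (a ≈P oneP) ⊎ (b ≈P oneP))

SquareFree : Poly → Set
SquareFree f = ∀ g → mulP g g ∣P f → g ≈P oneP

-- o(f) = k : k is the least common multiple of the degrees of the
-- irreducible factors of f (stated via the universal property of lcm)
HasOrder : Poly → ℕ → Set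
HasOrder f k =
  (∀ g d → Irreducible g → g ∣P f → HasDegree g d → d ∣ k) ×
  (∀ n → (∀ g d → Irreducible g → g ∣P f → HasDegree g d → d ∣ n) → k ∣ n)

-- Every divisor of p ^ i * q (i ≥ 1) other than p ^ i and p ^ i * q divides
-- p ^ (i - 1) * q.  So if f had no irreducible factor of degree p ^ i or
-- p ^ i * q, the lcm o(f) = p ^ i * q of the degrees of its irreducible factors
-- would divide the smaller number p ^ (i - 1) * q.  The witness is found
-- constructively by deciding whether f has an irreducible factor of a given
-- degree: every candidate factor, cofactor and factorization that has to be
-- inspected has bounded degree, so this is a finite search over coefficient
-- vectors.
{-# OPTIONS --safe #-}
module Submission where

open import Defs
open import Data.Bool using (Bool; true; false; _xor_; _∧_)
import Data.Bool as Bool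
open import Data.Bool.Properties using (∧-zeroʳ; xor-identityʳ)
open import Data.List using ([]; _∷_; length)
open import Data.Vec using (Vec; toList; []; _∷_)
open import Data.Vec.Properties using (length-toList)
open import Data.Fin.Subset.Properties using (anySubset?)
open import Data.Nat
  using (ℕ; zero; suc; _<_; _≤_; _+_; _*_; _^_; z≤n; s≤s; z<s; _≤?_; _<?_; nonTrivial⇒n>1)
open import Data.Nat.Properties
  using (<-cmp; ≤-trans; <⇒≤; <⇒≱; ≮⇒≥; m≤m+n; m≤n+m; allUpTo?; +-identityʳ; *-identityˡ;
         *-assoc; *-comm; *-cancelʳ-≡; m<m*n; m^n≢0; m*n≢0)
open import Data.Nat.Divisibility using (_∣_; _∣?_; divides; ∣⇒≤; *-monoˡ-∣; *-cancelˡ-∣)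
open import Data.Nat.Coprimality using (Coprime; coprime-divisor)
open import Data.Nat.Primality using (Prime; prime⇒nonZero; prime⇒nonTrivial; prime⇒irreducible)
open import Data.Product using (Σ; ∃; _×_; _,_; proj₁; proj₂; ∃-syntax)
open import Data.Sum using (_⊎_; inj₁; inj₂; [_,_]′)
open import Function using (_∘_)
open import Relation.Binary using (tri<; tri≈; tri>)
open import Relation.Nullary using (¬_; Dec; yes; no; contradiction)
open import Relation.Nullary.Decidable using (map′; _×-dec_; _⊎-dec_; ¬?; decidable-stable)
open import Relation.Binary.PropositionalEquality

prime∤⇒coprime : ∀ {p c} → Prime p → ¬ p ∣ c → Coprime c p
prime∤⇒coprime pp p∤c (i∣c , i∣p) with prime⇒irreducible pp i∣p
... | inj₁ i≡1 = i≡1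
... | inj₂ refl = contradiction i∣c p∤c

coprime-divisor-^ : ∀ {c p} k o → Coprime c p → c ∣ p ^ k * o → c ∣ o
coprime-divisor-^ {c} zero o _ c∣o = subst (c ∣_) (+-identityʳ o) c∣o
coprime-divisor-^ {c} {p} (suc k) o c⊥p c∣pᵏ⁺¹o =
  coprime-divisor-^ k o c⊥p (coprime-divisor c⊥p (subst (c ∣_) (*-assoc p (p ^ k) o) c∣pᵏ⁺¹o))

-- The cofactor c of d is either divisible by p, so that d divides p ^ j * q,
-- or coprime to p, so that it divides q.
∣p^[1+j]*q⇒ : ∀ {p q d} j → Prime p → Prime q → d ∣ p ^ suc j * q →
  d ∣ p ^ j * q ⊎ d ≡ p ^ suc j ⊎ d ≡ p ^ suc j * q
∣p^[1+j]*q⇒ {p} {q} {d} j pp pq (divides c pq≡cd) with p ∣? c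
... | yes p∣c =
  inj₁ (*-cancelˡ-∣ p {{prime⇒nonZero pp}} (subst (p * d ∣_) cd≡p*p^j*q (*-monoˡ-∣ d p∣c)))
  where
  cd≡p*p^j*q : c * d ≡ p * (p ^ j * q)
  cd≡p*p^j*q = trans (sym pq≡cd) (*-assoc p (p ^ j) q)
... | no p∤c with prime⇒irreducible pq c∣q
  where
  c∣q : c ∣ q
  c∣q = coprime-divisor-^ (suc j) q (prime∤⇒coprime pp p∤c) (divides d (trans pq≡cd (*-comm c d)))
...   | inj₁ refl = inj₂ (inj₂ (sym (trans pq≡cd (*-identityˡ d))))
...   | inj₂ refl =
  inj₂ (inj₁ (sym (*-cancelʳ-≡ (p ^ suc j) d q {{prime⇒nonZero pq}} (trans pq≡cd (*-comm q d)))))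

p^[1+j]*q∤p^j*q : ∀ {p q} j → Prime p → Prime q → ¬ p ^ suc j * q ∣ p ^ j * q
p^[1+j]*q∤p^j*q {p} {q} j pp pq p^[1+j]*q∣p^j*q = <⇒≱ p^j*q<p^[1+j]*q (∣⇒≤ p^[1+j]*q∣p^j*q)
  where
  instance
    _ = prime⇒nonZero pp
    _ = prime⇒nonZero pq
    _ = m^n≢0 p j
    _ = m*n≢0 (p ^ j) q
  p^j*q<p^[1+j]*q : p ^ j * q < p ^ suc j * q
  p^j*q<p^[1+j]*q = subst (p ^ j * q <_) (trans (*-comm (p ^ j * q) p) (sym (*-assoc p (p ^ j) q)))
                      (m<m*n (p ^ j * q) p (nonTrivial⇒n>1 p {{prime⇒nonTrivial pp}}))

≈P-refl : ∀ p → p ≈P p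
≈P-refl _ _ = refl

≈P-sym : ∀ p q → p ≈P q → q ≈P p
≈P-sym _ _ p≈q i = sym (p≈q i)

≈P-trans : ∀ p q r → p ≈P q → q ≈P r → p ≈P r
≈P-trans _ _ _ p≈q q≈r i = trans (p≈q i) (q≈r i)

tailP : Poly → Poly
tailP []      = []
tailP (_ ∷ p) = p

coeff-tailP : ∀ p i → coeff (tailP p) i ≡ coeff p (suc i)
coeff-tailP []      _ = refl
coeff-tailP (_ ∷ _) _ = refl

∷-≈P : ∀ {a} p r → a ≡ coeff r 0 → p ≈P tailP r → (a ∷ p) ≈P r
∷-≈P _ _ a≡r₀ _    zero    = a≡r₀
∷-≈P _ r _    p≈r′ (suc i) = trans (p≈r′ i) (coeff-tailP r i)

coeff-addP : ∀ p q i → coeff (addP p q) i ≡ coeff p i xor coeff q i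
coeff-addP []      _       _       = refl
coeff-addP (_ ∷ _) []      _       = sym (xor-identityʳ _)
coeff-addP (_ ∷ _) (_ ∷ _) zero    = refl
coeff-addP (_ ∷ p) (_ ∷ q) (suc i) = coeff-addP p q i

coeff-scaleP : ∀ c q i → coeff (scaleP c q) i ≡ c ∧ coeff q i
coeff-scaleP c []      _       = sym (∧-zeroʳ c)
coeff-scaleP _ (_ ∷ _) zero    = refl
coeff-scaleP c (_ ∷ q) (suc i) = coeff-scaleP c q i

coeff-mulP-∷ : ∀ a p q i → coeff (mulP (a ∷ p) q) i ≡ (a ∧ coeff q i) xor coeff (false ∷ mulP p q) i
coeff-mulP-∷ a p q i = trans (coeff-addP (scaleP a q) _ i) (cong (_xor _) (coeff-scaleP a q i))

mulP-zeroˡ : ∀ p q → p ≈P [] → mulP p q ≈P []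
mulP-zeroˡ []      _ _   _ = refl
mulP-zeroˡ (a ∷ p) q p≈0 i rewrite coeff-mulP-∷ a p q i | p≈0 0 =
  ∷-≈P (mulP p q) [] refl (mulP-zeroˡ p q (p≈0 ∘ suc)) i

mulP-zeroʳ : ∀ p → mulP p [] ≈P []
mulP-zeroʳ []      _ = refl
mulP-zeroʳ (a ∷ p) i rewrite coeff-mulP-∷ a p [] i | ∧-zeroʳ a =
  ∷-≈P (mulP p []) [] refl (mulP-zeroʳ p) i

mulP-congˡ : ∀ p p′ q → p ≈P p′ → mulP p q ≈P mulP p′ q
mulP-congˡ []      p′       q p≈p′ = ≈P-sym (mulP p′ q) [] (mulP-zeroˡ p′ q (≈P-sym [] p′ p≈p′))
mulP-congˡ (a ∷ p) []       q p≈p′ = mulP-zeroˡ (a ∷ p) q p≈p′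
mulP-congˡ (a ∷ p) (b ∷ p′) q p≈p′ i rewrite coeff-mulP-∷ a p q i | coeff-mulP-∷ b p′ q i | p≈p′ 0 =
  cong (b ∧ coeff q i xor_) (∷-≈P (mulP p q) (false ∷ mulP p′ q) refl (mulP-congˡ p p′ q (p≈p′ ∘ suc)) i)

mulP-congʳ : ∀ p q q′ → q ≈P q′ → mulP p q ≈P mulP p q′
mulP-congʳ []      _ _  _    _ = refl
mulP-congʳ (a ∷ p) q q′ q≈q′ i rewrite coeff-mulP-∷ a p q i | coeff-mulP-∷ a p q′ i =
  cong₂ _xor_ (cong (a ∧_) (q≈q′ i)) (∷-≈P (mulP p q) (false ∷ mulP p q′) refl (mulP-congʳ p q q′ q≈q′) i)

mulP-identityˡ : ∀ p q → p ≈P oneP → mulP p q ≈P q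
mulP-identityˡ p q p≈1 = ≈P-trans (mulP p q) (mulP oneP q) q (mulP-congˡ p oneP q p≈1) oneP*q≈q
  where
  oneP*q≈q : mulP oneP q ≈P q
  oneP*q≈q zero    = trans (coeff-mulP-∷ true [] q 0) (xor-identityʳ _)
  oneP*q≈q (suc i) = trans (coeff-mulP-∷ true [] q (suc i)) (xor-identityʳ _)

Bounded : ℕ → Poly → Set
Bounded n p = ∀ i → n ≤ i → coeff p i ≡ false

length-bounded : ∀ p → Bounded (length p) p
length-bounded []      _       _         = refl
length-bounded (_ ∷ p) (suc i) (s≤s n≤i) = length-bounded p i n≤i

degree-bounded : ∀ p {d e} → HasDegree p d → d ≤ e → Bounded (suc e) p
degree-bounded _ (_ , high) d≤e i e<i = high i (≤-trans (s≤s d≤e) e<i)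

HasDegree-resp : ∀ p q {d} → p ≈P q → HasDegree p d → HasDegree q d
HasDegree-resp p q {d} p≈q (top , high) =
  trans (sym (p≈q d)) top , λ i d<i → trans (sym (p≈q i)) (high i d<i)

degree-unique : ∀ p {d e} → HasDegree p d → HasDegree p e → d ≡ e
degree-unique _ {d} {e} (top-d , high-d) (top-e , high-e) with <-cmp d e
... | tri< d<e _ _ = contradiction (trans (sym top-e) (high-d e d<e)) λ ()
... | tri≈ _ d≡e _ = d≡e
... | tri> _ _ e<d = contradiction (trans (sym top-d) (high-e d e<d)) λ ()

degree-or-zero : ∀ p → p ≈P [] ⊎ ∃[ d ] HasDegree p d
degree-or-zero [] = inj₁ (≈P-refl [])
degree-or-zero (a ∷ p) with degree-or-zero p
... | inj₂ (d , top , high) = inj₂ (suc d , top , λ { (suc i) (s≤s d<i) → high i d<i })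
degree-or-zero (false ∷ p) | inj₁ p≈0 = inj₁ (∷-≈P p [] refl p≈0)
degree-or-zero (true ∷ p)  | inj₁ p≈0 = inj₂ (0 , refl , λ { (suc i) _ → p≈0 i })

mulP-degree : ∀ a b {da db} → HasDegree a da → HasDegree b db → HasDegree (mulP a b) (da + db)
mulP-degree [] _ (() , _) _
mulP-degree (a₀ ∷ a) b {zero} ha hb =
  HasDegree-resp b (mulP (a₀ ∷ a) b) (≈P-sym (mulP (a₀ ∷ a) b) b (mulP-identityˡ (a₀ ∷ a) b a≈1)) hb
  where
  a≈1 : (a₀ ∷ a) ≈P oneP
  a≈1 zero    = proj₁ ha
  a≈1 (suc i) = proj₂ ha (suc i) z<s
mulP-degree (a₀ ∷ a) b {suc da} {db} (top-a , high-a) hb = top , high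
  where
  ih : HasDegree (mulP a b) (da + db)
  ih = mulP-degree a b (top-a , λ i da<i → high-a (suc i) (s≤s da<i)) hb
  shift : ∀ k → db ≤ k → coeff (mulP (a₀ ∷ a) b) (suc k) ≡ coeff (mulP a b) k
  shift k db≤k rewrite coeff-mulP-∷ a₀ a b (suc k) | proj₂ hb (suc k) (s≤s db≤k) | ∧-zeroʳ a₀ = refl
  top : coeff (mulP (a₀ ∷ a) b) (suc (da + db)) ≡ true
  top = trans (shift (da + db) (m≤n+m db da)) (proj₁ ih)
  high : ∀ i → suc (da + db) < i → coeff (mulP (a₀ ∷ a) b) i ≡ false
  high (suc i) (s≤s da+db<i) = trans (shift i (≤-trans (m≤n+m db da) (<⇒≤ da+db<i))) (proj₂ ih i da+db<i)

≈P? : ∀ p q → Dec (p ≈P q)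
≈P? p q = map′ extend (λ p≈q {i} _ → p≈q i) (allUpTo? (λ i → coeff p i Bool.≟ coeff q i) n)
  where
  n = length p + length q
  extend : (∀ {i} → i < n → coeff p i ≡ coeff q i) → p ≈P q
  extend agree i with i <? n
  ... | yes i<n = agree i<n
  ... | no  i≮n = trans (length-bounded p i (≤-trans (m≤m+n _ _) (≮⇒≥ i≮n)))
                        (sym (length-bounded q i (≤-trans (m≤n+m _ _) (≮⇒≥ i≮n))))

factors-bounded : ∀ a b {d} → HasDegree (mulP a b) d → Bounded (suc d) a × Bounded (suc d) b
factors-bounded a b hab with degree-or-zero a | degree-or-zero b
... | inj₁ a≈0 | _ = contradiction (trans (sym (proj₁ hab)) (mulP-zeroˡ a b a≈0 _)) λ ()
... | inj₂ _ | inj₁ b≈0 = contradiction (trans (sym (proj₁ hab)) (ab≈0 _)) λ ()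
  where
  ab≈0 : mulP a b ≈P []
  ab≈0 = ≈P-trans (mulP a b) (mulP a []) [] (mulP-congʳ a b [] b≈0) (mulP-zeroʳ a)
... | inj₂ (da , ha) | inj₂ (db , hb) rewrite degree-unique (mulP a b) hab (mulP-degree a b ha hb) =
  degree-bounded a ha (m≤m+n da db) , degree-bounded b hb (m≤n+m db da)

toList-bounded : ∀ {n} (v : Vec Bool n) → Bounded n (toList v)
toList-bounded v i n≤i = length-bounded (toList v) i (subst (_≤ i) (sym (length-toList v)) n≤i)

truncate : ∀ n p → Bounded n p → Σ (Vec Bool n) λ v → toList v ≈P p
truncate zero    p p<0 = [] , λ i → sym (p<0 i z≤n)
truncate (suc n) p p<n+1 with truncate n (tailP p) tailP<n
  where
  tailP<n : Bounded n (tailP p)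
  tailP<n i n≤i = trans (coeff-tailP p i) (p<n+1 (suc i) (s≤s n≤i))
... | v , v≈p′ = coeff p 0 ∷ v , ∷-≈P (toList v) p refl v≈p′

-- Vec Bool n is Subset n, so anySubset? enumerates all coefficient vectors.
bounded-search : ∀ n (P : Poly → Set) →
  (∀ p p′ → p ≈P p′ → P p → P p′) → (∀ p → P p → Bounded n p) →
  ((v : Vec Bool n) → Dec (P (toList v))) → Dec (∃ P)
bounded-search n P respects bounded P? with anySubset? P?
... | yes (v , Pv) = yes (toList v , Pv)
... | no ¬∃v = no λ (p , Pp) → let (v , v≈p) = truncate n p (bounded p Pp) in
  ¬∃v (v , respects p (toList v) (≈P-sym (toList v) p v≈p) Pp)

∣P-respˡ : ∀ f g g′ → g ≈P g′ → g ∣P f → g′ ∣P f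
∣P-respˡ f g g′ g≈g′ (h , gh≈f) =
  h , ≈P-trans (mulP g′ h) (mulP g h) f (mulP-congˡ g′ g h (≈P-sym g g′ g≈g′)) gh≈f

∣P? : ∀ f {m} → HasDegree f m → ∀ g → Dec (g ∣P f)
∣P? f {m} hf g = bounded-search (suc m) Cofactor respects bounded (λ v → ≈P? (mulP g (toList v)) f)
  where
  Cofactor : Poly → Set
  Cofactor h = mulP g h ≈P f
  respects : ∀ h h′ → h ≈P h′ → Cofactor h → Cofactor h′
  respects h h′ h≈h′ gh≈f =
    ≈P-trans (mulP g h′) (mulP g h) f (mulP-congʳ g h′ h (≈P-sym h h′ h≈h′)) gh≈f
  bounded : ∀ h → Cofactor h → Bounded (suc m) h
  bounded h gh≈f = proj₂ (factors-bounded g h (HasDegree-resp f (mulP g h) (≈P-sym (mulP g h) f gh≈f) hf))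

ProperFactorization : Poly → Poly → Poly → Set
ProperFactorization g a b = mulP a b ≈P g × ¬ a ≈P oneP × ¬ b ≈P oneP

properFactorization? : ∀ g {d} → HasDegree g d → Dec (∃[ a ] ∃[ b ] ProperFactorization g a b)
properFactorization? g {d} hg =
  bounded-search (suc d) (λ a → ∃ (ProperFactorization g a)) respectsˡ
    (λ a (b , ab≈g , _) → proj₁ (bounds a b ab≈g)) λ v →
  bounded-search (suc d) (ProperFactorization g (toList v)) (respectsʳ (toList v))
    (λ b (ab≈g , _) → proj₂ (bounds (toList v) b ab≈g)) λ w →
  ≈P? (mulP (toList v) (toList w)) g ×-dec ¬? (≈P? (toList v) oneP) ×-dec ¬? (≈P? (toList w) oneP)
  where
  bounds : ∀ a b → mulP a b ≈P g → Bounded (suc d) a × Bounded (suc d) b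
  bounds a b ab≈g = factors-bounded a b (HasDegree-resp g (mulP a b) (≈P-sym (mulP a b) g ab≈g) hg)
  respectsʳ : ∀ a b b′ → b ≈P b′ → ProperFactorization g a b → ProperFactorization g a b′
  respectsʳ a b b′ b≈b′ (ab≈g , a≉1 , b≉1) =
    ≈P-trans (mulP a b′) (mulP a b) g (mulP-congʳ a b′ b (≈P-sym b b′ b≈b′)) ab≈g ,
    a≉1 , b≉1 ∘ ≈P-trans b b′ oneP b≈b′
  respectsˡ : ∀ a a′ → a ≈P a′ → ∃ (ProperFactorization g a) → ∃ (ProperFactorization g a′)
  respectsˡ a a′ a≈a′ (b , ab≈g , a≉1 , b≉1) =
    b , ≈P-trans (mulP a′ b) (mulP a b) g (mulP-congˡ a′ a b (≈P-sym a a′ a≈a′)) ab≈g ,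
    a≉1 ∘ ≈P-trans a a′ oneP a≈a′ , b≉1

irreducible? : ∀ g {d} → HasDegree g d → Dec (Irreducible g)
irreducible? g {d} hg with 1 ≤? d | properFactorization? g hg
... | no d<1 | _ = no λ ((d′ , 1≤d′ , hg′) , _) → d<1 (subst (1 ≤_) (degree-unique g hg′ hg) 1≤d′)
... | yes _ | yes (a , b , ab≈g , a≉1 , b≉1) = no λ (_ , irr) → [ a≉1 , b≉1 ]′ (irr a b ab≈g)
... | yes 1≤d | no ¬split = yes ((d , 1≤d , hg) , λ a b ab≈g →
  decidable-stable (≈P? a oneP ⊎-dec ≈P? b oneP) λ ¬unit →
    ¬split (a , b , ab≈g , ¬unit ∘ inj₁ , ¬unit ∘ inj₂))

Irreducible-resp : ∀ g g′ → g ≈P g′ → Irreducible g → Irreducible g′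
Irreducible-resp g g′ g≈g′ ((d , 1≤d , hg) , irr) =
  (d , 1≤d , HasDegree-resp g g′ g≈g′ hg) ,
  λ a b ab≈g′ → irr a b (≈P-trans (mulP a b) g′ g ab≈g′ (≈P-sym g g′ g≈g′))

IrreducibleFactor : Poly → ℕ → Poly → Set
IrreducibleFactor f d g = Irreducible g × g ∣P f × HasDegree g d

irreducibleFactor? : ∀ f {m} → HasDegree f m → ∀ d → Dec (∃ (IrreducibleFactor f d))
irreducibleFactor? f hf d =
  bounded-search (suc d) (IrreducibleFactor f d) respects (λ _ (_ , _ , hg) → proj₂ hg) decide
  where
  respects : ∀ g g′ → g ≈P g′ → IrreducibleFactor f d g → IrreducibleFactor f d g′
  respects g g′ g≈g′ (irr , g∣f , hg) =
    Irreducible-resp g g′ g≈g′ irr , ∣P-respˡ f g g′ g≈g′ g∣f , HasDegree-resp g g′ g≈g′ hg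
  decide : (v : Vec Bool (suc d)) → Dec (IrreducibleFactor f d (toList v))
  decide v with coeff (toList v) d Bool.≟ true
  ... | no top≢true = no (top≢true ∘ proj₁ ∘ proj₂ ∘ proj₂)
  ... | yes top = map′ (λ (irr , v∣f) → irr , v∣f , hv) (λ (irr , v∣f , _) → irr , v∣f)
                       (irreducible? (toList v) hv ×-dec ∣P? f hf (toList v))
    where
    hv : HasDegree (toList v) d
    hv = top , toList-bounded v

mainTheorem3 : (p q i : ℕ) (f : Poly) →
    Prime p → Prime q → p < q → 1 ≤ i →
    HasDegree f (p ^ i * q) → SquareFree f → HasOrder f (p ^ i * q) →
    ∃[ g ] ∃[ d ] (Irreducible g × g ∣P f × HasDegree g d ×
      ((d ≡ p ^ i) ⊎ (d ≡ p ^ i * q)))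
mainTheorem3 p q (suc j) f pp pq _ _ hf _ (degrees∣o , o∣common)
  with irreducibleFactor? f hf (p ^ suc j) | irreducibleFactor? f hf (p ^ suc j * q)
... | yes (g , irr , g∣f , hg) | _ = g , p ^ suc j , irr , g∣f , hg , inj₁ refl
... | no _ | yes (g , irr , g∣f , hg) = g , p ^ suc j * q , irr , g∣f , hg , inj₂ refl
... | no ¬deg-pʲ⁺¹ | no ¬deg-pʲ⁺¹q =
  contradiction (o∣common (p ^ j * q) degrees∣pʲq) (p^[1+j]*q∤p^j*q j pp pq)
  where
  degrees∣pʲq : ∀ g d → Irreducible g → g ∣P f → HasDegree g d → d ∣ p ^ j * q
  degrees∣pʲq g d irr g∣f hg with ∣p^[1+j]*q⇒ j pp pq (degrees∣o g d irr g∣f hg)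
  ... | inj₁ d∣pʲq = d∣pʲq
  ... | inj₂ (inj₁ refl) = contradiction (g , irr , g∣f , hg) ¬deg-pʲ⁺¹
  ... | inj₂ (inj₂ refl) = contradiction (g , irr , g∣f , hg) ¬deg-pʲ⁺¹q
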